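{- Let $(G,s,t)$ be a minimal weak link and let $b$ be a pivot of it with $b\in B_s=\Gamma(s)$. Then there is no edge of $G$ joining a vertex of $\Gamma(b)\setminus\{s\}$ to a vertex of $B_s\setminus\{b\}$.
   Context: A Shannon game (link) $(G,s,t)$ consists of a finite simple graph $G$ and two distinct designated vertices $s,t$, the terminals. Two players, Short and Cut, alternately select a not-yet-selected non-terminal vertex; Short claims ("shorts") his vertices, Cut deletes ("cuts") his. Shorting $v$ is equivalent to deleting $v$ and making all pairs of its former neighbours adjacent. Short wins if at the end there is an $s$–$t$ path all of whose internal vertices are claimed by Short (equivalently, $s,t$ become adjacent); otherwise Cut wins. The link is strong if Short has a winning strategy when moving second, and weak if Short has a winning strategy when moving first but not when moving second. A weak link is minimal if deleting any single edge produces a game in which Short has no winning strategy as first player. A pivot of a weak link is a non-terminal vertex which, if shorted, turns the link into a strong link. $B_s=\Gamma(s)$ denotes the neighbourhood of $s$. -}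

module Defs where

open import Data.Nat using (ℕ)
open import Data.Fin using (Fin; _≟_)
open import Data.Product using (_×_; Σ)
open import Data.Sum using (_⊎_)
open import Data.Empty using (⊥)
open import Relation.Nullary using (¬_; yes; no)
open import Relation.Binary.PropositionalEquality using (_≡_; _≢_)
open import Level using (0ℓ)

record Graph (n : ℕ) : Set₁ where
  field
    Adj   : Fin n → Fin n → Set
    sym   : ∀ {x y} → Adj x y → Adj y x
    irrefl : ∀ {x} → ¬ Adj x x
open Graph public

deleteEdge : ∀ {n} → (G : Graph n) → Fin n → Fin n → Graph n
deleteEdge G u v = record
  { Adj = λ x y → Adj G x y × ¬ ((x ≡ u × y ≡ v) ⊎ (x ≡ v × y ≡ u))
  ; sym = λ { (a , h) → sym G a , λ { (Data.Sum.inj₁ (p , q)) → h (Data.Sum.inj₂ (q , p))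
                                     ; (Data.Sum.inj₂ (p , q)) → h (Data.Sum.inj₁ (q , p)) } }
  ; irrefl = λ { (a , _) → irrefl G a }
  }
  where open Data.Product using (_,_)

data Status : Set where
  free short cut : Status

Position : ℕ → Set
Position n = Fin n → Status

initial : ∀ {n} → Position n
initial _ = free

update : ∀ {n} → Position n → Fin n → Status → Position n
update p v σ x with x ≟ v
... | yes _ = σ
... | no  _ = p x

module Game {n : ℕ} (G : Graph n) (s t : Fin n) where

  NonTerminal : Fin n → Set
  NonTerminal v = v ≢ s × v ≢ t

  Available : Position n → Fin n → Set
  Available p v = NonTerminal v × p v ≡ free

  Finished : Position n → Set
  Finished p = ∀ v → NonTerminal v → ¬ (p v ≡ free)

  data ShortReach (p : Position n) : Fin n → Set where
    base : ∀ {v} → Adj G s v → ShortReach p v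
    step : ∀ {u v} → ShortReach p u → p u ≡ short → Adj G u v → ShortReach p v

  ShortConnected : Position n → Set
  ShortConnected p = ShortReach p t

  data WinShortToMove (p : Position n) : Set
  data WinCutToMove (p : Position n) : Set

  data WinShortToMove p where
    endS  : Finished p → ShortConnected p → WinShortToMove p
    moveS : ∀ v → Available p v → WinCutToMove (update p v short) → WinShortToMove p

  data WinCutToMove p where
    endC  : Finished p → ShortConnected p → WinCutToMove p
    moveC : ¬ Finished p →
            (∀ v → Available p v → WinShortToMove (update p v cut)) → WinCutToMove p

  ShortWinsFirst : Set
  ShortWinsFirst = WinShortToMove initial

  ShortWinsSecond : Set
  ShortWinsSecond = WinCutToMove initial

StrongLink : ∀ {n} → Graph n → Fin n → Fin n → Set
StrongLink G s t = Game.ShortWinsSecond G s t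

WeakLink : ∀ {n} → Graph n → Fin n → Fin n → Set
WeakLink G s t = Game.ShortWinsFirst G s t × ¬ Game.ShortWinsSecond G s t

MinimalWeakLink : ∀ {n} → Graph n → Fin n → Fin n → Set
MinimalWeakLink G s t =
  WeakLink G s t ×
  (∀ u v → Adj G u v → ¬ Game.ShortWinsFirst (deleteEdge G u v) s t)

-- b is a pivot: a non-terminal vertex such that after Short claims b
-- (and Cut is to move) Short has a winning strategy, i.e. the shorted game is a strong link
Pivot : ∀ {n} → Graph n → Fin n → Fin n → Fin n → Set
Pivot G s t b =
  Game.NonTerminal G s t b × Game.WinCutToMove G s t (update initial b short)

module Submission where

-- With b shorted, x is joined to s through s–b–x and y is a neighbour of s.
-- Hence Short wins (G − xy, s, t) as first player by opening with b and then
-- following the pivot strategy, contradicting minimality.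

open import Defs
open import Data.Nat using (ℕ)
open import Data.Fin using (Fin; _≟_)
open import Data.Product using (_×_; Σ; _,_)
open import Data.Sum using (_⊎_; inj₁; inj₂)
open import Relation.Nullary using (¬_; yes; no; contradiction)
open import Relation.Nullary.Decidable using (_×-dec_; _⊎-dec_)
open import Relation.Binary.PropositionalEquality
  using (_≡_; _≢_; refl; subst) renaming (sym to ≡-sym)

update-updated : ∀ {n} (p : Position n) v σ → update p v σ v ≡ σ
update-updated p v σ with v ≟ v
... | yes _  = refl
... | no v≢v = contradiction refl v≢v

update-other : ∀ {n} (p : Position n) {u v} σ → u ≢ v → update p v σ u ≡ p u
update-other p {u} {v} σ u≢v with u ≟ v
... | yes u≡v = contradiction u≡v u≢v
... | no _    = refl

update-preserves-short : ∀ {n} (p : Position n) {u v} σ →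
  p u ≡ short → p v ≡ free → update p v σ u ≡ short
update-preserves-short p {u} {v} σ pu≡short pv≡free =
  subst (_≡ short) (≡-sym (update-other p σ u≢v)) pu≡short
  where
    u≢v : u ≢ v
    u≢v refl with subst (_≡ free) pu≡short pv≡free
    ... | ()

SameEdge : ∀ {n} → Fin n → Fin n → Fin n → Fin n → Set
SameEdge u v x y = (u ≡ x × v ≡ y) ⊎ (u ≡ y × v ≡ x)

SameEdge-endpoint : ∀ {n} {u v x y : Fin n} → SameEdge u v x y → v ≡ x ⊎ v ≡ y
SameEdge-endpoint (inj₁ (_ , v≡y)) = inj₂ v≡y
SameEdge-endpoint (inj₂ (_ , v≡x)) = inj₁ v≡x

deleteEdge-preserves : ∀ {n} (G : Graph n) {x y u v} →
  Adj G u v → ¬ SameEdge u v x y → Adj (deleteEdge G x y) u v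
deleteEdge-preserves G uv ¬same = uv , ¬same

deleteEdge-split : ∀ {n} (G : Graph n) x y {u v} →
  Adj G u v → Adj (deleteEdge G x y) u v ⊎ SameEdge u v x y
deleteEdge-split G x y {u} {v} uv
  with ((u ≟ x) ×-dec (v ≟ y)) ⊎-dec ((u ≟ y) ×-dec (v ≟ x))
... | yes same = inj₂ same
... | no ¬same = inj₁ (deleteEdge-preserves G uv ¬same)

shortReach-deleteEdge : ∀ {n} (G : Graph n) (s t x y : Fin n) (p : Position n) →
  let module G  = Game G s t
      module G' = Game (deleteEdge G x y) s t
  in G'.ShortReach p x → G'.ShortReach p y → ∀ {v} → G.ShortReach p v → G'.ShortReach p v
shortReach-deleteEdge G s t x y p reach-x reach-y = transfer
  where
    module G  = Game G s t
    module G' = Game (deleteEdge G x y) s t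

    endpoint : ∀ {v} → v ≡ x ⊎ v ≡ y → G'.ShortReach p v
    endpoint (inj₁ refl) = reach-x
    endpoint (inj₂ refl) = reach-y

    transfer : ∀ {v} → G.ShortReach p v → G'.ShortReach p v
    transfer (G.base sv) with deleteEdge-split G x y sv
    ... | inj₁ sv'  = G'.base sv'
    ... | inj₂ same = endpoint (SameEdge-endpoint same)
    transfer (G.step r pu uv) with deleteEdge-split G x y uv
    ... | inj₁ uv'  = G'.step (transfer r) pu uv'
    ... | inj₂ same = endpoint (SameEdge-endpoint same)

-- Games on the same vertex set have the same positions and moves, so a strategy
-- carries over as long as an invariant of play turns G-connections into H-connections.
module WinTransfer {n : ℕ} (G H : Graph n) (s t : Fin n)
  (Inv : Position n → Set)
  (Inv-update : ∀ p v σ → Inv p → Game.Available G s t p v → Inv (update p v σ))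
  (connected : ∀ p → Inv p → Game.ShortConnected G s t p → Game.ShortConnected H s t p)
  where

  private
    module G = Game G s t
    module H = Game H s t

  winShortToMove : ∀ p → Inv p → G.WinShortToMove p → H.WinShortToMove p
  winCutToMove   : ∀ p → Inv p → G.WinCutToMove p → H.WinCutToMove p
  winShortToMove p inv (G.endS fin con)  = H.endS fin (connected p inv con)
  winShortToMove p inv (G.moveS v av w)  =
    H.moveS v av (winCutToMove _ (Inv-update p v short inv av) w)
  winCutToMove   p inv (G.endC fin con)  = H.endC fin (connected p inv con)
  winCutToMove   p inv (G.moveC fin win) =
    H.moveC fin (λ v av → winShortToMove _ (Inv-update p v cut inv av) (win v av))

lemma6 : ∀ {n} (G : Graph n) (s t b : Fin n) → s ≢ t →
    MinimalWeakLink G s t → Pivot G s t b → Adj G s b →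
    ¬ (Σ (Fin n) λ x → Σ (Fin n) λ y →
         (Adj G b x × x ≢ s) × (Adj G s y × y ≢ b) × Adj G x y)
lemma6 G s t b _ (_ , minimal) (b-nonterminal , pivot-win) sb
       (x , y , (bx , x≢s) , (sy , y≢b) , xy) =
  minimal x y xy
    (G'.moveS b (b-nonterminal , refl)
      (winCutToMove _ (update-updated initial b short) pivot-win))
  where
    G' : Graph _
    G' = deleteEdge G x y
    module G' = Game G' s t

    sb' : Adj G' s b
    sb' = deleteEdge-preserves G sb
      λ { (inj₁ (s≡x , _)) → x≢s (≡-sym s≡x)
        ; (inj₂ (_ , b≡x)) → irrefl G (subst (λ z → Adj G z x) b≡x bx) }

    bx' : Adj G' b x
    bx' = deleteEdge-preserves G bx
      λ { (inj₁ (b≡x , _)) → irrefl G (subst (λ z → Adj G z x) b≡x bx)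
        ; (inj₂ (b≡y , _)) → y≢b (≡-sym b≡y) }

    sy' : Adj G' s y
    sy' = deleteEdge-preserves G sy
      λ { (inj₁ (s≡x , _)) → x≢s (≡-sym s≡x)
        ; (inj₂ (s≡y , _)) → irrefl G (subst (λ z → Adj G z y) s≡y sy) }

    connected : ∀ p → p b ≡ short → Game.ShortConnected G s t p → G'.ShortConnected p
    connected p pb≡short =
      shortReach-deleteEdge G s t x y p (G'.step (G'.base sb') pb≡short bx') (G'.base sy')

    open WinTransfer G G' s t (λ p → p b ≡ short)
      (λ p v σ pb≡short (_ , pv≡free) → update-preserves-short p σ pb≡short pv≡free)
      connected
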